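{- For every integer $k\ge 1$ and every integer $n\ge 3$, \[ c^{2k+1}_{\text{even}}(n) = c^{2k+1}_{\text{even}}(n-1)+2c^{2k+1}_{\text{even}}(n-2)-c^{2k+1}_{\text{even}}(n-2-2k-1),\] \[ c^{2k}_{\text{odd}}(n) = c^{2k}_{\text{odd}}(n-1)+2c^{2k}_{\text{odd}}(n-2)-c^{2k}_{\text{odd}}(n-2-2k).\]
   Context: For a nonnegative integer $k$, $C^{2k}_{\text{odd}}(n)$ is the set of compositions of $n$ (finite sequences of positive integers summing to $n$) whose parts all lie in the set of positive odd integers together with the even integers $2,\ldots,2k$, and $C^{2k+1}_{\text{even}}(n)$ is the set of compositions of $n$ whose parts all lie in the set of positive even integers together with the odd integers $1,3,\ldots,2k+1$; $c^{2k}_{\text{odd}}(n)$ and $c^{2k+1}_{\text{even}}(n)$ are their cardinalities. Conventions: the value at $0$ is $1$ (the empty composition) and values at negative arguments are $0$. -}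

module Defs where

open import Data.Nat using (ℕ; zero; suc; _+_; _*_; _≤_; _≤?_)
open import Data.Nat.Properties using (≤-refl)
open import Data.Nat using (_%_)
open import Data.Bool using (Bool; true; false; _∧_; _∨_; not)
open import Data.List using (List; []; _∷_; map; concatMap; filter; length; upTo)
open import Data.Integer using (ℤ; +_; -[1+_])
open import Relation.Nullary.Decidable using (⌊_⌋)

-- A composition is a list of positive integers. compositions n enumerates
-- ALL compositions of n (each exactly once): first part p ∈ {1..n}, then
-- a composition of n - p.  Defined by strong recursion via a fuel argument.
compositionsFuel : ℕ → ℕ → List (List ℕ)
compositionsFuel fuel zero = [] ∷ []
compositionsFuel zero (suc n) = []
compositionsFuel (suc fuel) (suc n) =
  concatMap (λ q → map (λ c → (suc n Data.Nat.∸ q) ∷ c) (compositionsFuel fuel q)) (upTo (suc n))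
  -- q = n+1 - p ranges over 0..n, i.e. first part p ranges over 1..n+1

compositions : ℕ → List (List ℕ)
compositions n = compositionsFuel n n

isOdd : ℕ → Bool
isOdd p = ⌊ p % 2 Data.Nat.≟ 1 ⌋

allowedOdd : ℕ → ℕ → Bool
allowedOdd k p = ⌊ 1 ≤? p ⌋ ∧ (isOdd p ∨ ⌊ p ≤? 2 * k ⌋)

allowedEven : ℕ → ℕ → Bool
allowedEven k p = ⌊ 1 ≤? p ⌋ ∧ (not (isOdd p) ∨ ⌊ p ≤? 2 * k + 1 ⌋)

allParts : (ℕ → Bool) → List ℕ → Bool
allParts P [] = true
allParts P (x ∷ xs) = P x ∧ allParts P xs

countComps : (ℕ → Bool) → ℕ → ℕ
countComps allowed n = length (filter (λ c → allParts allowed c Data.Bool.≟ true) (compositions n))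

-- c^{2k}_odd(n) and c^{2k+1}_even(n) for natural n
c-odd : ℕ → ℕ → ℕ
c-odd k = countComps (allowedOdd k)

c-even : ℕ → ℕ → ℕ
c-even k = countComps (allowedEven k)

-- extension to integer arguments: value 0 at negative arguments
extℤ : (ℕ → ℕ) → ℤ → ℤ
extℤ f (+ n) = + f n
extℤ f -[1+ n ] = + 0

cℤ-odd : ℕ → ℤ → ℤ
cℤ-odd k = extℤ (c-odd k)

cℤ-even : ℕ → ℤ → ℤ
cℤ-even k = extℤ (c-even k)

{-# OPTIONS --safe #-}
module Submission where

-- Splitting off the first part p gives c(n) = Σ_{p ≥ 1} [p allowed] c(n − p). In both families 1 and 2
-- are allowed, and the set of allowed parts is 2-periodic on the positive integers except that
-- e (= 2k+1, resp. 2k) is allowed while e + 2 is not. Hence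
--   c(n) − c(n−1) − c(n−2) = Σ_{p ≥ 1} [p + 2 allowed] c(n − 2 − p) = c(n − 2) − c(n − 2 − e).

open import Defs
open import Data.Nat using (ℕ; zero; suc; _≤_; _<_; _≤?_; _≟_; z≤n; s≤s)
open import Data.Bool using (Bool; true; false; if_then_else_; _∧_; _∨_; not)
open import Data.Product using (_×_; _,_)
open import Function using (_∘_)
open import Relation.Binary.PropositionalEquality
open import Relation.Nullary using (Dec; does; yes; no)
open import Relation.Nullary.Decidable using (⌊_⌋; isYes≗does; dec-true; dec-false)

module Sums where

  open import Data.Nat using (_+_; _∸_)
  open import Data.Nat.Properties using (+-assoc; +-comm; +-identityʳ)
  open import Data.Nat.ListAction using (sum)
  open import Data.Nat.ListAction.Properties using (sum-++)
  open import Data.List using ([]; _∷_; _++_; map; applyUpTo; upTo)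
  open import Data.List.Properties using (map-upTo; map-cong-local; applyUpTo-∷ʳ)
  import Data.List.Relation.Unary.All as All
  open import Data.List.Relation.Unary.All.Properties using (all-upTo)

  ∑< : ℕ → (ℕ → ℕ) → ℕ
  ∑< m f = sum (applyUpTo f m)

  syntax ∑< m (λ j → e) = ∑[ j < m ] e

  map-cong-upTo : ∀ {A : Set} m {f g : ℕ → A} → (∀ {j} → j < m → f j ≡ g j) → map f (upTo m) ≡ map g (upTo m)
  map-cong-upTo m f≗g = map-cong-local (All.map f≗g (all-upTo m))

  ∑-cong< : ∀ m {f g : ℕ → ℕ} → (∀ {j} → j < m → f j ≡ g j) → ∑< m f ≡ ∑< m g
  ∑-cong< m {f} {g} f≗g = cong sum (begin
    applyUpTo f m    ≡⟨ map-upTo f m ⟨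
    map f (upTo m)   ≡⟨ map-cong-upTo m f≗g ⟩
    map g (upTo m)   ≡⟨ map-upTo g m ⟩
    applyUpTo g m    ∎)
    where open ≡-Reasoning

  ∑-snoc : ∀ m f → ∑< (suc m) f ≡ ∑< m f + f m
  ∑-snoc m f = begin
    sum (applyUpTo f (suc m))         ≡⟨ cong sum (applyUpTo-∷ʳ f m) ⟨
    sum (applyUpTo f m ++ f m ∷ [])   ≡⟨ sum-++ (applyUpTo f m) (f m ∷ []) ⟩
    ∑< m f + (f m + 0)                ≡⟨ cong (∑< m f +_) (+-identityʳ (f m)) ⟩
    ∑< m f + f m                      ∎
    where open ≡-Reasoning

  ∑-reverse : ∀ m f → ∑< m f ≡ ∑[ j < m ] f (m ∸ suc j)
  ∑-reverse zero    f = refl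
  ∑-reverse (suc m) f = begin
    ∑< (suc m) f                        ≡⟨ ∑-snoc m f ⟩
    ∑< m f + f m                        ≡⟨ cong (_+ f m) (∑-reverse m f) ⟩
    ∑[ j < m ] f (m ∸ suc j) + f m      ≡⟨ +-comm _ (f m) ⟩
    ∑[ j < suc m ] f (suc m ∸ suc j)    ∎
    where open ≡-Reasoning

  ∑-+ : ∀ m f g → ∑< m f + ∑< m g ≡ ∑[ j < m ] (f j + g j)
  ∑-+ zero    f g = refl
  ∑-+ (suc m) f g = begin
    (f 0 + F) + (g 0 + G)   ≡⟨ +-assoc (f 0) F (g 0 + G) ⟩
    f 0 + (F + (g 0 + G))   ≡⟨ cong (f 0 +_) (+-comm F (g 0 + G)) ⟩
    f 0 + ((g 0 + G) + F)   ≡⟨ cong (f 0 +_) (+-assoc (g 0) G F) ⟩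
    f 0 + (g 0 + (G + F))   ≡⟨ cong (λ x → f 0 + (g 0 + x)) (+-comm G F) ⟩
    f 0 + (g 0 + (F + G))   ≡⟨ +-assoc (f 0) (g 0) (F + G) ⟨
    (f 0 + g 0) + (F + G)   ≡⟨ cong (f 0 + g 0 +_) (∑-+ m (f ∘ suc) (g ∘ suc)) ⟩
    ∑[ j < suc m ] (f j + g j) ∎
    where
    open ≡-Reasoning
    F = ∑< m (f ∘ suc)
    G = ∑< m (g ∘ suc)

  ∑-zero : ∀ m → ∑[ j < m ] 0 ≡ 0
  ∑-zero zero    = refl
  ∑-zero (suc m) = ∑-zero m

  -- Indicators use does (j ≟ d), which reduces to does (j′ ≟ d′) at successors; ⌊ j ≟ d ⌋ does not.
  ∑-indicator-< : ∀ {m d} (g : ℕ → ℕ) → d < m → ∑[ j < m ] (if does (j ≟ d) then g j else 0) ≡ g d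
  ∑-indicator-< {suc m} {zero}  g _         = trans (cong (g 0 +_) (∑-zero m)) (+-identityʳ (g 0))
  ∑-indicator-< {suc m} {suc d} g (s≤s d<m) = ∑-indicator-< (g ∘ suc) d<m

  ∑-indicator-≥ : ∀ {m d} (g : ℕ → ℕ) → m ≤ d → ∑[ j < m ] (if does (j ≟ d) then g j else 0) ≡ 0
  ∑-indicator-≥ {zero}          g _         = refl
  ∑-indicator-≥ {suc m} {suc d} g (s≤s m≤d) = ∑-indicator-≥ (g ∘ suc) m≤d

module Enumeration where

  open Sums using (map-cong-upTo)
  open import Data.Nat using (_∸_)
  open import Data.Nat.Properties using (≤-trans; ≤-pred)
  open import Data.List using (_∷_; map; concat)

  compositionsFuel-irrelevant : ∀ {f f′ n} → n ≤ f → n ≤ f′ → compositionsFuel f n ≡ compositionsFuel f′ n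
  compositionsFuel-irrelevant {n = zero} _ _ = refl
  compositionsFuel-irrelevant {suc f} {suc f′} {suc n} (s≤s n≤f) (s≤s n≤f′) =
    cong concat (map-cong-upTo (suc n) λ {q} q≤n →
      cong (map ((suc n ∸ q) ∷_))
        (compositionsFuel-irrelevant (≤-trans (≤-pred q≤n) n≤f) (≤-trans (≤-pred q≤n) n≤f′)))

module Counting (P : ℕ → Bool) where

  open Sums
  open Enumeration
  open import Data.Nat using (_+_; _*_; _∸_)
  open import Data.Nat.Properties
    using (≤-refl; ≤-pred; suc-injective; +-assoc; +-identityʳ; +-∸-assoc; m∸n≤m; m∸[m∸n]≡n)
  open import Data.Nat.ListAction using (sum)
  open import Data.List using (List; []; _∷_; _++_; map; concatMap; filter; length; upTo)
  open import Data.List.Properties using (length-++; filter-++; map-upTo)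
  import Data.Bool as Bool

  admissible? : (c : List ℕ) → Dec (allParts P c ≡ true)
  admissible? c = allParts P c Bool.≟ true

  count : List (List ℕ) → ℕ
  count cs = length (filter admissible? cs)

  count-concatMap : ∀ {A : Set} (G : A → List (List ℕ)) xs → count (concatMap G xs) ≡ sum (map (count ∘ G) xs)
  count-concatMap G []       = refl
  count-concatMap G (x ∷ xs) = begin
    count (G x ++ concatMap G xs)
      ≡⟨ cong length (filter-++ admissible? (G x) (concatMap G xs)) ⟩
    length (filter admissible? (G x) ++ filter admissible? (concatMap G xs))
      ≡⟨ length-++ (filter admissible? (G x)) ⟩
    count (G x) + count (concatMap G xs)
      ≡⟨ cong (count (G x) +_) (count-concatMap G xs) ⟩
    count (G x) + sum (map (count ∘ G) xs) ∎
    where open ≡-Reasoning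

  count-map-∷ : ∀ x cs → count (map (x ∷_) cs) ≡ (if P x then count cs else 0)
  count-map-∷ x cs with P x in Px
  ... | true  = accepted cs
    where
    accepted : ∀ cs → count (map (x ∷_) cs) ≡ count cs
    accepted []       = refl
    accepted (c ∷ cs) rewrite Px with does (admissible? c)
    ... | true  = cong suc (accepted cs)
    ... | false = accepted cs
  ... | false = rejected cs
    where
    rejected : ∀ cs → count (map (x ∷_) cs) ≡ 0
    rejected []       = refl
    rejected (c ∷ cs) rewrite Px = rejected cs

  countComps-by-remainder : ∀ n →
    countComps P (suc n) ≡ ∑[ q < suc n ] (if P (suc n ∸ q) then countComps P q else 0)
  countComps-by-remainder n = begin
    count (concatMap G (upTo (suc n)))      ≡⟨ count-concatMap G (upTo (suc n)) ⟩
    sum (map (count ∘ G) (upTo (suc n)))    ≡⟨ cong sum (map-upTo (count ∘ G) (suc n)) ⟩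
    ∑[ q < suc n ] count (G q)              ≡⟨ ∑-cong< (suc n) count-G ⟩
    ∑[ q < suc n ] (if P (suc n ∸ q) then countComps P q else 0) ∎
    where
    open ≡-Reasoning
    G : ℕ → List (List ℕ)
    G q = map ((suc n ∸ q) ∷_) (compositionsFuel n q)
    count-G : ∀ {q} → q < suc n → count (G q) ≡ (if P (suc n ∸ q) then countComps P q else 0)
    count-G {q} q≤n = trans (count-map-∷ (suc n ∸ q) (compositionsFuel n q))
      (cong (λ cs → if P (suc n ∸ q) then count cs else 0) (compositionsFuel-irrelevant (≤-pred q≤n) ≤-refl))

  countComps-by-first-part : ∀ n →
    countComps P (suc n) ≡ ∑[ j < suc n ] (if P (suc j) then countComps P (n ∸ j) else 0)
  countComps-by-first-part n =
    trans (countComps-by-remainder n) (trans (∑-reverse (suc n) by-remainder) (∑-cong< (suc n) first-part))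
    where
    by-remainder : ℕ → ℕ
    by-remainder q = if P (suc n ∸ q) then countComps P q else 0
    first-part : ∀ {j} → j < suc n →
      (if P (suc n ∸ (n ∸ j)) then countComps P (n ∸ j) else 0) ≡ (if P (suc j) then countComps P (n ∸ j) else 0)
    first-part {j} j≤n = cong (λ p → if P p then countComps P (n ∸ j) else 0)
      (trans (+-∸-assoc 1 (m∸n≤m n j)) (cong suc (m∸[m∸n]≡n (≤-pred j≤n))))

  record TwoPeriodicExceptAt (e : ℕ) : Set where
    field
      allowed-at      : P e ≡ true
      forbidden-after : P (2 + e) ≡ false
      periodic        : ∀ j → 1 ≤ j → j ≢ e → P (2 + j) ≡ P j

  open TwoPeriodicExceptAt

  weight-shift : ∀ {d} → TwoPeriodicExceptAt (suc d) → ∀ j x →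
    (if P (3 + j) then x else 0) + (if does (j ≟ d) then x else 0) ≡ (if P (1 + j) then x else 0)
  weight-shift {d} tp j x with j ≟ d
  ... | yes refl rewrite allowed-at tp | forbidden-after tp | dec-true (j ≟ j) refl = refl
  ... | no j≢d   rewrite periodic tp (suc j) (s≤s z≤n) (j≢d ∘ suc-injective) | dec-false (j ≟ d) j≢d =
    +-identityʳ _

  countComps-recurrence : ∀ {d} → P 1 ≡ true → P 2 ≡ true → TwoPeriodicExceptAt (suc d) → ∀ n →
    countComps P (3 + n) + ∑[ j < suc n ] (if does (j ≟ d) then countComps P (n ∸ j) else 0)
      ≡ countComps P (2 + n) + 2 * countComps P (1 + n)
  countComps-recurrence {d} P1 P2 tp n = begin
    c (3 + n) + δ
      ≡⟨ cong (_+ δ) (countComps-by-first-part (2 + n)) ⟩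
    (w (P 1) (c (2 + n)) + (w (P 2) (c (1 + n)) + S)) + δ
      ≡⟨ cong₂ (λ a b → (w a (c (2 + n)) + (w b (c (1 + n)) + S)) + δ) P1 P2 ⟩
    (c (2 + n) + (c (1 + n) + S)) + δ
      ≡⟨ +-assoc (c (2 + n)) (c (1 + n) + S) δ ⟩
    c (2 + n) + ((c (1 + n) + S) + δ)
      ≡⟨ cong (c (2 + n) +_) (+-assoc (c (1 + n)) S δ) ⟩
    c (2 + n) + (c (1 + n) + (S + δ))
      ≡⟨ cong (λ x → c (2 + n) + (c (1 + n) + x)) (trans S+δ≡c[1+n] (sym (+-identityʳ _))) ⟩
    c (2 + n) + 2 * c (1 + n) ∎
    where
    open ≡-Reasoning
    c : ℕ → ℕ
    c = countComps P
    w : Bool → ℕ → ℕ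
    w b x = if b then x else 0
    S δ : ℕ
    S = ∑[ j < suc n ] w (P (3 + j)) (c (n ∸ j))
    δ = ∑[ j < suc n ] w (does (j ≟ d)) (c (n ∸ j))
    S+δ≡c[1+n] : S + δ ≡ c (1 + n)
    S+δ≡c[1+n] = begin
      S + δ
        ≡⟨ ∑-+ (suc n) (λ j → w (P (3 + j)) (c (n ∸ j))) (λ j → w (does (j ≟ d)) (c (n ∸ j))) ⟩
      ∑[ j < suc n ] (w (P (3 + j)) (c (n ∸ j)) + w (does (j ≟ d)) (c (n ∸ j)))
        ≡⟨ ∑-cong< (suc n) (λ {j} _ → weight-shift tp j (c (n ∸ j))) ⟩
      ∑[ j < suc n ] w (P (1 + j)) (c (n ∸ j))
        ≡⟨ countComps-by-first-part n ⟨
      c (1 + n) ∎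

module AllowedParts where

  open Counting using (TwoPeriodicExceptAt)
  open import Data.Nat using (_+_; _*_; _%_)
  open import Data.Nat.Properties
    using (≤-refl; ≤-trans; n≤1+n; 1+n≰n; ≤∧≢⇒<; +-comm; *-suc; *-monoʳ-≤; m≤m+n; m≤n+m)
  open import Data.Nat.DivMod using ([m+n]%n≡m%n)
  open import Data.Bool.Properties using (not-involutive; ∨-zeroʳ)
  open import Data.Empty using (⊥-elim)

  isOdd-2+ : ∀ j → isOdd (2 + j) ≡ isOdd j
  isOdd-2+ j = cong (λ r → ⌊ r ≟ 1 ⌋) (trans (cong (_% 2) (+-comm 2 j)) ([m+n]%n≡m%n j 2))

  isOdd-suc : ∀ j → isOdd (suc j) ≡ not (isOdd j)
  isOdd-suc zero          = refl
  isOdd-suc (suc zero)    = refl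
  isOdd-suc (suc (suc j)) =
    trans (isOdd-2+ (suc j)) (trans (isOdd-suc j) (cong not (sym (isOdd-2+ j))))

  isOdd-double : ∀ k → isOdd (2 * k) ≡ false
  isOdd-double zero    = refl
  isOdd-double (suc k) = trans (cong isOdd (*-suc 2 k)) (trans (isOdd-2+ (2 * k)) (isOdd-double k))

  Alternating : (ℕ → Bool) → Set
  Alternating Q = ∀ j → Q (suc j) ≡ not (Q j)

  -- allowedEven k is definitionally atMostOr (2 * k + 1) (not ∘ isOdd), and allowedOdd k is atMostOr (2 * k) isOdd.
  atMostOr : ℕ → (ℕ → Bool) → ℕ → Bool
  atMostOr t Q j = ⌊ 1 ≤? j ⌋ ∧ (Q j ∨ ⌊ j ≤? t ⌋)

  ⌊≤?⌋-true : ∀ {a b} → a ≤ b → ⌊ a ≤? b ⌋ ≡ true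
  ⌊≤?⌋-true {a} {b} a≤b = trans (isYes≗does (a ≤? b)) (dec-true (a ≤? b) a≤b)

  ⌊≤?⌋-cong : ∀ {a b c d} → (a ≤ b → c ≤ d) → (c ≤ d → a ≤ b) → ⌊ a ≤? b ⌋ ≡ ⌊ c ≤? d ⌋
  ⌊≤?⌋-cong {a} {b} {c} {d} to from with a ≤? b | c ≤? d
  ... | yes _   | yes _   = refl
  ... | no  _   | no  _   = refl
  ... | yes a≤b | no  c≰d = ⊥-elim (c≰d (to a≤b))
  ... | no  a≰b | yes c≤d = ⊥-elim (a≰b (from c≤d))

  atMostOr-≤ : ∀ {t Q j} → 1 ≤ j → j ≤ t → atMostOr t Q j ≡ true
  atMostOr-≤ {Q = Q} {j = suc i} _ j≤t = trans (cong (Q (suc i) ∨_) (⌊≤?⌋-true j≤t)) (∨-zeroʳ _)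

  atMostOr-twoPeriodic : ∀ {t Q} → Alternating Q → Q t ≡ false → 1 ≤ t →
    TwoPeriodicExceptAt (atMostOr t Q) t
  atMostOr-twoPeriodic {t} {Q} alternating Qt≡false 1≤t = record
    { allowed-at      = atMostOr-≤ {Q = Q} 1≤t ≤-refl
    ; forbidden-after = cong₂ _∨_ (trans (Q-2+ t) Qt≡false)
        (trans (isYes≗does (2 + t ≤? t)) (dec-false (2 + t ≤? t) (λ h → 1+n≰n (≤-trans (n≤1+n _) h))))
    ; periodic        = periodic
    }
    where
    Q-2+ : ∀ j → Q (2 + j) ≡ Q j
    Q-2+ j = trans (alternating (suc j)) (trans (cong not (alternating j)) (not-involutive (Q j)))
    periodic : ∀ j → 1 ≤ j → j ≢ t → atMostOr t Q (2 + j) ≡ atMostOr t Q j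
    periodic (suc i) _ j≢t rewrite Q-2+ (suc i) with Q (suc i) in Qj
    ... | true  = refl
    ... | false = ⌊≤?⌋-cong (λ h → ≤-trans (n≤1+n _) (≤-trans (n≤1+n _) h)) (λ h → ≤∧≢⇒< (≤∧≢⇒< h j≢t) 2+i≢t)
      where
      2+i≢t : 2 + i ≢ t
      2+i≢t 2+i≡t with trans (sym (trans (alternating (suc i)) (cong not Qj))) (trans (cong Q 2+i≡t) Qt≡false)
      ... | ()

  allowedEven-twoPeriodic : ∀ k → TwoPeriodicExceptAt (allowedEven k) (2 * k + 1)
  allowedEven-twoPeriodic k =
    atMostOr-twoPeriodic {Q = not ∘ isOdd} (cong not ∘ isOdd-suc) 2k+1-odd (m≤n+m 1 (2 * k))
    where
    2k+1-odd : not (isOdd (2 * k + 1)) ≡ false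
    2k+1-odd = cong not (begin
      isOdd (2 * k + 1)      ≡⟨ cong isOdd (+-comm (2 * k) 1) ⟩
      isOdd (suc (2 * k))    ≡⟨ isOdd-suc (2 * k) ⟩
      not (isOdd (2 * k))    ≡⟨ cong not (isOdd-double k) ⟩
      true                   ∎)
      where open ≡-Reasoning

  allowedOdd-twoPeriodic : ∀ {k} → 1 ≤ k → TwoPeriodicExceptAt (allowedOdd k) (2 * k)
  allowedOdd-twoPeriodic {k} 1≤k =
    atMostOr-twoPeriodic {Q = isOdd} isOdd-suc (isOdd-double k) (≤-trans 1≤k (m≤m+n k (k + 0)))

  allowedEven-one : ∀ k → allowedEven k 1 ≡ true
  allowedEven-one k = atMostOr-≤ {Q = not ∘ isOdd} (s≤s z≤n) (m≤n+m 1 (2 * k))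

  allowedOdd-two : ∀ {k} → 1 ≤ k → allowedOdd k 2 ≡ true
  allowedOdd-two 1≤k = atMostOr-≤ {Q = isOdd} (s≤s z≤n) (*-monoʳ-≤ 2 1≤k)

open Sums using (∑<; ∑-indicator-<; ∑-indicator-≥)
open Counting using (TwoPeriodicExceptAt; countComps-recurrence)
open Counting.TwoPeriodicExceptAt using (forbidden-after)
open AllowedParts

import Data.Nat as ℕ
open import Data.Nat.Properties using (≰⇒>; m<n⇒0<n∸m)
open import Data.Integer using (+_; _+_; _-_; _*_; -_)
open import Data.Integer.Properties using (m-n≡m⊖n; ⊖-≥; ⊖-<; pos-*)
open import Data.Integer.Tactic.RingSolver using (solve-∀)

extℤ-minus-≥ : ∀ (f : ℕ → ℕ) {m n} → n ≤ m → extℤ f (+ m - + n) ≡ + f (m ℕ.∸ n)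
extℤ-minus-≥ f {m} {n} n≤m = cong (extℤ f) (trans (m-n≡m⊖n m n) (⊖-≥ n≤m))

extℤ-minus-< : ∀ (f : ℕ → ℕ) {m n} → m < n → extℤ f (+ m - + n) ≡ + 0
extℤ-minus-< f {m} {n} m<n =
  trans (cong (extℤ f) (trans (m-n≡m⊖n m n) (⊖-< m<n))) (vanishes-at-negative (m<n⇒0<n∸m m<n))
  where
  vanishes-at-negative : ∀ {x} → 0 < x → extℤ f (- + x) ≡ + 0
  vanishes-at-negative {suc _} _ = refl

extℤ-minus-as-indicator-sum : ∀ (f : ℕ → ℕ) n d →
  extℤ f (+ suc n - + suc d) ≡ + ∑[ j < suc n ] (if does (j ≟ d) then f (n ℕ.∸ j) else 0)
extℤ-minus-as-indicator-sum f n d with d ≤? n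
... | yes d≤n = trans (extℤ-minus-≥ f (s≤s d≤n))
                  (cong +_ (sym (∑-indicator-< (λ j → f (n ℕ.∸ j)) (s≤s d≤n))))
... | no d≰n  = trans (extℤ-minus-< f (s≤s (≰⇒> d≰n)))
                  (cong +_ (sym (∑-indicator-≥ (λ j → f (n ℕ.∸ j)) (≰⇒> d≰n))))

m+n≡o⇒m≡o-n : ∀ {m n o} → m ℕ.+ n ≡ o → + m ≡ + o - + n
m+n≡o⇒m≡o-n {m} {n} refl = add-sub (+ m) (+ n)
  where
  add-sub : ∀ x y → x ≡ x + y - y
  add-sub = solve-∀

countComps-recurrenceℤ : ∀ {P e} → P 1 ≡ true → P 2 ≡ true → TwoPeriodicExceptAt P e →
  ∀ n {i} → i ≡ + (1 ℕ.+ n) - + e →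
  extℤ (countComps P) (+ (3 ℕ.+ n))
    ≡ extℤ (countComps P) (+ (3 ℕ.+ n) - + 1) + + 2 * extℤ (countComps P) (+ (3 ℕ.+ n) - + 2)
      - extℤ (countComps P) i
countComps-recurrenceℤ {P} {zero} P1 P2 tp n _ with trans (sym P2) (forbidden-after tp)
... | ()
countComps-recurrenceℤ {P} {suc d} P1 P2 tp n refl = begin
  + c (3 ℕ.+ n)
    ≡⟨ m+n≡o⇒m≡o-n (countComps-recurrence P P1 P2 tp n) ⟩
  + (c (2 ℕ.+ n) ℕ.+ 2 ℕ.* c (1 ℕ.+ n)) - + δ
    ≡⟨ cong (λ x → + c (2 ℕ.+ n) + x - + δ) (pos-* 2 (c (1 ℕ.+ n))) ⟩
  + c (2 ℕ.+ n) + + 2 * + c (1 ℕ.+ n) - + ∑[ j < suc n ] (if does (j ≟ d) then c (n ℕ.∸ j) else 0)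
    ≡⟨ cong (λ x → + c (2 ℕ.+ n) + + 2 * + c (1 ℕ.+ n) - x) (extℤ-minus-as-indicator-sum c n d) ⟨
  + c (2 ℕ.+ n) + + 2 * + c (1 ℕ.+ n) - extℤ c (+ (1 ℕ.+ n) - + suc d) ∎
  where
  open ≡-Reasoning
  c : ℕ → ℕ
  c = countComps P
  δ : ℕ
  δ = ∑[ j < suc n ] (if does (j ≟ d) then c (n ℕ.∸ j) else 0)

index-even : ∀ m k → + (3 ℕ.+ m) - + 2 - + 2 * + k - + 1 ≡ + (1 ℕ.+ m) - + (2 ℕ.* k ℕ.+ 1)
index-even m k = trans (rearrange (+ m) (+ k)) (cong (λ x → + (1 ℕ.+ m) - (x + + 1)) (sym (pos-* 2 k)))
  where
  rearrange : ∀ x y → + 3 + x - + 2 - + 2 * y - + 1 ≡ + 1 + x - (+ 2 * y + + 1)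
  rearrange = solve-∀

index-odd : ∀ m k → + (3 ℕ.+ m) - + 2 - + 2 * + k ≡ + (1 ℕ.+ m) - + (2 ℕ.* k)
index-odd m k = trans (rearrange (+ m) (+ k)) (cong (λ x → + (1 ℕ.+ m) - x) (sym (pos-* 2 k)))
  where
  rearrange : ∀ x y → + 3 + x - + 2 - + 2 * y ≡ + 1 + x - + 2 * y
  rearrange = solve-∀

corollary4p6 : (k n : ℕ) → 1 ≤ k → 3 ≤ n →
    (cℤ-even k (+ n) ≡ cℤ-even k (+ n - + 1) + + 2 * cℤ-even k (+ n - + 2) - cℤ-even k (+ n - + 2 - + 2 * + k - + 1))
    × (cℤ-odd k (+ n) ≡ cℤ-odd k (+ n - + 1) + + 2 * cℤ-odd k (+ n - + 2) - cℤ-odd k (+ n - + 2 - + 2 * + k))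
corollary4p6 k (suc (suc (suc m))) 1≤k (s≤s (s≤s (s≤s _))) =
    countComps-recurrenceℤ (allowedEven-one k) refl (allowedEven-twoPeriodic k) m (index-even m k)
  , countComps-recurrenceℤ refl (allowedOdd-two 1≤k) (allowedOdd-twoPeriodic 1≤k) m (index-odd m k)
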